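{- Let $M$ be a Steiner quasigroup, let $A\subseteq M$ be a finite free base of $M$, and let $B\subseteq M$ be a set of generators of $M$. Then $|A|=|B|$ if and only if $B$ is a free base of $M$.
   Context: A Steiner quasigroup is a set $M$ with a binary operation $\cdot$ satisfying $x\cdot y=y\cdot x$, $x\cdot x=x$ and $x\cdot(x\cdot y)=y$ for all $x,y$. For $A\subseteq M$, $\langle A\rangle_M$ denotes the substructure (subalgebra) of $M$ generated by $A$. A subset $A\subseteq M$ is independent if $\langle A\rangle_M$ is freely generated by $A$ in the class of Steiner quasigroups, i.e. for every Steiner quasigroup $N$ every map $A\to N$ extends to a homomorphism $\langle A\rangle_M\to N$. A free base of $M$ is an independent subset of $M$ that generates $M$. -}

module Defs where

open import Data.Nat using (ℕ)
open import Data.Fin using (Fin)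
open import Data.Product using (Σ; ∃; _,_; proj₁)
open import Function.Bundles using (_↔_)
open import Relation.Binary.PropositionalEquality using (_≡_)

record SteinerQuasigroup : Set₁ where
  infixl 7 _·_
  field
    Carrier : Set
    _·_     : Carrier → Carrier → Carrier
    comm    : ∀ x y → x · y ≡ y · x
    idem    : ∀ x → x · x ≡ x
    cancel  : ∀ x y → x · (x · y) ≡ y

Subset : Set → Set₁
Subset X = X → Set

IsProp : {X : Set} → Subset X → Set
IsProp {X} A = ∀ (x : X) (p q : A x) → p ≡ q

El : {X : Set} → Subset X → Set
El {X} A = Σ X A

Finite : {X : Set} → Subset X → Set
Finite A = ∃ λ (n : ℕ) → Fin n ↔ El A

SameCard : {X : Set} → Subset X → Subset X → Set
SameCard A B = El A ↔ El B

module _ (M : SteinerQuasigroup) where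
  open SteinerQuasigroup M

  data ⟨_⟩ (A : Subset Carrier) : Subset Carrier where
    base : ∀ {x} → A x → ⟨ A ⟩ x
    op   : ∀ {x y} → ⟨ A ⟩ x → ⟨ A ⟩ y → ⟨ A ⟩ (x · y)

  Generates : Subset Carrier → Set
  Generates A = ∀ x → ⟨ A ⟩ x

  -- A homomorphism ⟨ A ⟩_M → N (a function on the generated subset that
  -- depends only on the element, not on the membership witness).
  record SubHom (A : Subset Carrier) (N : SteinerQuasigroup) : Set where
    module N = SteinerQuasigroup N
    field
      fun      : El ⟨ A ⟩ → N.Carrier
      wd       : ∀ x (p q : ⟨ A ⟩ x) → fun (x , p) ≡ fun (x , q)
      hom      : ∀ x y (p : ⟨ A ⟩ x) (q : ⟨ A ⟩ y) →
                 fun (x · y , op p q) ≡ N._·_ (fun (x , p)) (fun (y , q))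

  Independent : Subset Carrier → Set₁
  Independent A = ∀ (N : SteinerQuasigroup) (f : El A → SteinerQuasigroup.Carrier N) →
    Σ (SubHom A N) λ h → ∀ x (p : A x) → SubHom.fun h (x , base p) ≡ f (x , p)

  record FreeBase (A : Subset Carrier) : Set₁ where
    field
      independent : Independent A
      generating  : Generates A

{-# OPTIONS --safe #-}
module Submission where

-- Let A be a free base of M with n elements.  Valuations A → N then correspond to homomorphisms
-- M → N, and restricting homomorphisms to a generating set B is injective.  For N = ℤ/3 this gives
-- 3ⁿ ≤ 3^|B|, i.e. |A| ≤ |B|.  A free base B is finite, since each of its elements must occur in the
-- B-terms expressing the elements of A; hence any two free bases have the same size.
-- Conversely, a bijection A ≅ B induces an endomorphism φ of M mapping A onto B.  It is injective
-- because M is residually finite: distinct elements are separated by a finite quasigroup built from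
-- ℤ/3 by iterated extensions (x , s) · (y , t) = (x · y , c(x , y) − s − t), and for finite N the
-- injective map β ↦ β̄ ∘ φ on N^A is onto, so every separating map factors through φ.  A relation
-- among elements of B therefore pulls back along φ to a relation among elements of A, which holds
-- in every Steiner quasigroup; so B is free.

open import Defs
open import Data.Empty using (⊥; ⊥-elim)
open import Data.Unit using (⊤; tt)
open import Data.Fin as Fin using (Fin; zero; suc; toℕ)
open import Data.Fin.Patterns using (0F; 1F)
open import Data.Fin.Properties using (all?; any?; injective⇒≤; punchOut-injective; *↔×)
open import Data.List using (List; []; _∷_; _++_; length; lookup; concatMap; allFin; deduplicate)
open import Data.List.Membership.Propositional using (_∈_; _∉_; lose; find)
open import Data.List.Membership.Propositional.Properties
  using (∈-++⁺ˡ; ∈-++⁺ʳ; ∈-++⁻; ∈-lookup; ∈-allFin; ∈-concatMap⁺; ∈-deduplicate⁺)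
import Data.List.Membership.DecPropositional as DecMembership
open import Data.List.Relation.Binary.Subset.Propositional using (_⊆_)
open import Data.List.Relation.Binary.Subset.Propositional.Properties using (⊆-trans)
import Data.List.Relation.Unary.All as All
open import Data.List.Relation.Unary.AllPairs using (_∷_)
open import Data.List.Relation.Unary.Any as Any using (here; there; index)
open import Data.List.Relation.Unary.Any.Properties using (lookup-index)
open import Data.List.Relation.Unary.Unique.Propositional using (Unique)
open import Data.List.Relation.Unary.Unique.DecPropositional.Properties using (deduplicate-!)
open import Data.Nat using (ℕ; _+_; _*_; _^_; _≤_; _<_; s≤s; z≤n)
open import Data.Nat.DivMod using (_mod_)
open import Data.Nat.Properties using (<-irrefl; ≤-antisym; ^-monoʳ-<; ≰⇒>; <⇒≱; _≤?_)
open import Data.Product using (Σ; ∃; _×_; _,_; proj₁; proj₂; <_,_>)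
open import Data.Product.Function.NonDependent.Propositional using (_×-↔_)
open import Data.Sum using (_⊎_; inj₁; inj₂)
open import Data.Vec as Vec using (Vec; []; _∷_)
open import Data.Vec.Properties using (lookup∘tabulate; tabulate∘lookup; tabulate-cong)
open import Function using (_∘_; _↔_; _⇔_; mk⇔; mk↔ₛ′; Inverse; Injective; Injection; mk↣)
open import Function.Properties.Inverse using (↔-refl; ↔-sym; ↔-trans; ↔⇒↣)
open import Function.Properties.Injection using (↣-trans)
open import Relation.Binary.Definitions using (DecidableEquality)
open import Relation.Binary.PropositionalEquality
open import Relation.Nullary using (¬_; Dec; yes; no)
open import Relation.Nullary.Decidable using (from-yes; map′; via-injection; _×-dec_; _⊎-dec_; ¬?)

open SteinerQuasigroup using (Carrier)

private
  variable
    X Y C : Set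

Enumerable : Set → Set
Enumerable X = ∃ λ n → Fin n ↔ X

enumerable⇒≟ : Enumerable X → DecidableEquality X
enumerable⇒≟ (_ , e) = via-injection (↔⇒↣ (↔-sym e)) Fin._≟_

×-enumerable : Enumerable X → Enumerable Y → Enumerable (X × Y)
×-enumerable (m , e) (n , f) = m * n , ↔-trans *↔× (e ×-↔ f)

Vec-↔ : ∀ {c} → Fin c ↔ C → ∀ n → Fin (c ^ n) ↔ Vec C n
Vec-↔ e ℕ.zero = mk↔ₛ′ (λ _ → []) (λ _ → zero) (λ { [] → refl }) λ { zero → refl ; (suc ()) }
Vec-↔ e (ℕ.suc n) = ↔-trans *↔× (↔-trans (e ×-↔ Vec-↔ e n) uncons)
  where
  uncons : (_ × Vec _ n) ↔ Vec _ (ℕ.suc n)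
  uncons = mk↔ₛ′ (λ (x , xs) → x ∷ xs) (λ v → Vec.head v , Vec.tail v)
                 (λ { (x ∷ xs) → refl }) (λ _ → refl)

Fin-injective⇒surjective : ∀ {n} (f : Fin n → Fin n) → Injective _≡_ _≡_ f →
                           ∀ y → ∃ λ x → f x ≡ y
Fin-injective⇒surjective {ℕ.zero} f _ ()
Fin-injective⇒surjective {ℕ.suc n} f f-inj y with any? (λ x → f x Fin.≟ y)
... | yes hit = hit
... | no miss = ⊥-elim (<-irrefl refl (injective⇒≤ g-injective))
  where
  missed : ∀ x → y ≢ f x
  missed x y≡fx = miss (x , sym y≡fx)
  g : Fin (ℕ.suc n) → Fin n
  g x = Fin.punchOut (missed x)
  g-injective : Injective _≡_ _≡_ g
  g-injective {x} {x′} eq = f-inj (punchOut-injective (missed x) (missed x′) eq)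

injective⇒surjective : ∀ {n} → Fin n ↔ X → (f : X → X) → Injective _≡_ _≡_ f →
                       ∀ y → ∃ λ x → f x ≡ y
injective⇒surjective e f f-inj y
  with Fin-injective⇒surjective (Injection.to g) (Injection.injective g) (Inverse.from e y)
  where
  g : Injection _ _
  g = ↣-trans (↔⇒↣ e) (↣-trans (mk↣ f-inj) (↔⇒↣ (↔-sym e)))
... | i , gi≡y = Inverse.to e i , Injection.injective (↔⇒↣ (↔-sym e)) gi≡y

lookup-injective : {xs : List X} → Unique xs → Injective _≡_ _≡_ (lookup xs)
lookup-injective (_ ∷ _) {zero} {zero} _ = refl
lookup-injective (x∉ ∷ _) {zero} {suc j} eq = ⊥-elim (All.lookup x∉ (∈-lookup j) eq)
lookup-injective (x∉ ∷ _) {suc i} {zero} eq = ⊥-elim (All.lookup x∉ (∈-lookup i) (sym eq))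
lookup-injective (_ ∷ u) {suc i} {suc j} eq = cong suc (lookup-injective u eq)

listed⇒enumerable : DecidableEquality X → (xs : List X) → (∀ x → x ∈ xs) → Enumerable X
listed⇒enumerable _≟_ xs complete = length ys , mk↔ₛ′ (lookup ys) (index ∘ complete′)
  (λ x → sym (lookup-index (complete′ x)))
  (λ i → lookup-injective (deduplicate-! _≟_ xs) (sym (lookup-index (complete′ (lookup ys i)))))
  where
  ys = deduplicate _≟_ xs
  complete′ : ∀ x → x ∈ ys
  complete′ x = ∈-deduplicate⁺ _≟_ (complete x)

^-cancelʳ-≤ : ∀ c {k r} → 1 < c → c ^ k ≤ c ^ r → k ≤ r
^-cancelʳ-≤ c {k} {r} 1<c cᵏ≤cʳ with k ≤? r
... | yes k≤r = k≤r
... | no k≰r = ⊥-elim (<⇒≱ (^-monoʳ-< c 1<c (≰⇒> k≰r)) cᵏ≤cʳ)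

PointwiseInjective : {X Y C : Set} → ((X → C) → (Y → C)) → Set
PointwiseInjective {X} {Y} {C} F = ∀ (α β : X → C) → (∀ y → F α y ≡ F β y) → ∀ x → α x ≡ β x

module Tabulation {X C : Set} {n} (e : Fin n ↔ X) where
  open Inverse e

  encode : (X → C) → Vec C n
  encode α = Vec.tabulate (α ∘ to)

  decode : Vec C n → X → C
  decode v = Vec.lookup v ∘ from

  decode-encode : ∀ (α : X → C) x → decode (encode α) x ≡ α x
  decode-encode α x = trans (lookup∘tabulate (α ∘ to) (from x)) (cong α (strictlyInverseˡ x))

  encode-injective : ∀ {α β : X → C} → encode α ≡ encode β → ∀ x → α x ≡ β x
  encode-injective {α} {β} eq x =
    trans (sym (decode-encode α x)) (trans (cong (λ v → decode v x) eq) (decode-encode β x))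

  decode-injective : ∀ {v w : Vec C n} → (∀ x → decode v x ≡ decode w x) → v ≡ w
  decode-injective {v} {w} eq = begin
    v                            ≡⟨ tabulate∘lookup v ⟨
    Vec.tabulate (Vec.lookup v)  ≡⟨ tabulate-cong lookups ⟩
    Vec.tabulate (Vec.lookup w)  ≡⟨ tabulate∘lookup w ⟩
    w                            ∎
    where
    open ≡-Reasoning
    lookups : ∀ i → Vec.lookup v i ≡ Vec.lookup w i
    lookups i = subst (λ j → Vec.lookup v j ≡ Vec.lookup w j) (strictlyInverseʳ i) (eq (to i))

module _ {X Y C : Set} {k r} (eX : Fin k ↔ X) (eY : Fin r ↔ Y) where
  open Tabulation

  tabulated : ((X → C) → (Y → C)) → Vec C k → Vec C r
  tabulated F = encode eY ∘ F ∘ decode eX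

  tabulated-injective : ∀ {F} → PointwiseInjective F → Injective _≡_ _≡_ (tabulated F)
  tabulated-injective F-inj eq = decode-injective eX (F-inj _ _ (encode-injective eY eq))

pointwiseInjective⇒≤ : ∀ {k r c} → Fin k ↔ X → Fin r ↔ Y → Fin c ↔ C → 1 < c →
                       {F : (X → C) → (Y → C)} → PointwiseInjective F → k ≤ r
pointwiseInjective⇒≤ {k = k} {r} {c} eX eY eC 1<c F-inj =
  ^-cancelʳ-≤ c 1<c (injective⇒≤ (Injection.injective g))
  where
  g : Injection _ _
  g = ↣-trans (↔⇒↣ (Vec-↔ eC k))
        (↣-trans (mk↣ (tabulated-injective eX eY F-inj)) (↔⇒↣ (↔-sym (Vec-↔ eC r))))

pointwiseInjective⇒surjective : ∀ {n} → Fin n ↔ X → Enumerable C →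
  {F : (X → C) → (X → C)} → PointwiseInjective F → ∀ γ → ∃ λ α → ∀ x → F α x ≡ γ x
pointwiseInjective⇒surjective {n = n} eX (c , eC) {F} F-inj γ
  with injective⇒surjective (Vec-↔ eC n) (tabulated eX eX F) (tabulated-injective eX eX F-inj)
                            (Tabulation.encode eX γ)
... | v , F̂v≡γ̂ = Tabulation.decode eX v , Tabulation.encode-injective eX F̂v≡γ̂

infixl 7 _⊙_

data Term (X : Set) : Set where
  var : X → Term X
  _⊙_ : Term X → Term X → Term X

vars : Term X → List X
vars (var x) = x ∷ []
vars (s ⊙ t) = vars s ++ vars t

bind : Term X → (X → Term Y) → Term Y
bind (var x) σ = σ x
bind (s ⊙ t) σ = bind s σ ⊙ bind t σ

∈-vars-bind : ∀ {y} (t : Term X) (σ : X → Term Y) → y ∈ vars (bind t σ) →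
              ∃ λ x → y ∈ vars (σ x)
∈-vars-bind (var x) σ y∈ = x , y∈
∈-vars-bind (s ⊙ t) σ y∈ with ∈-++⁻ (vars (bind s σ)) y∈
... | inj₁ y∈s = ∈-vars-bind s σ y∈s
... | inj₂ y∈t = ∈-vars-bind t σ y∈t

Term-≟ : DecidableEquality X → DecidableEquality (Term X)
Term-≟ _≟_ (var x) (var y) = map′ (cong var) (λ { refl → refl }) (x ≟ y)
Term-≟ _≟_ (var _) (_ ⊙ _) = no λ ()
Term-≟ _≟_ (_ ⊙ _) (var _) = no λ ()
Term-≟ _≟_ (s ⊙ t) (s′ ⊙ t′) =
  map′ (λ (s≡s′ , t≡t′) → cong₂ _⊙_ s≡s′ t≡t′) (λ { refl → refl , refl })
       (Term-≟ _≟_ s s′ ×-dec Term-≟ _≟_ t t′)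

module _ (N : SteinerQuasigroup) where
  open SteinerQuasigroup N hiding (Carrier)

  eval : (X → Carrier N) → Term X → Carrier N
  eval ρ (var x) = ρ x
  eval ρ (s ⊙ t) = eval ρ s · eval ρ t

  eval-cong : ∀ {ρ ρ′ : X → Carrier N} → (∀ x → ρ x ≡ ρ′ x) → ∀ t → eval ρ t ≡ eval ρ′ t
  eval-cong ρ≗ρ′ (var x) = ρ≗ρ′ x
  eval-cong ρ≗ρ′ (s ⊙ t) = cong₂ _·_ (eval-cong ρ≗ρ′ s) (eval-cong ρ≗ρ′ t)

  eval-bind : ∀ (ρ : Y → Carrier N) (σ : X → Term Y) t →
              eval ρ (bind t σ) ≡ eval (eval ρ ∘ σ) t
  eval-bind ρ σ (var x) = refl
  eval-bind ρ σ (s ⊙ t) = cong₂ _·_ (eval-bind ρ σ s) (eval-bind ρ σ t)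

  triple-swap : ∀ {x y z} → x · y ≡ z → y · x ≡ z
  triple-swap {x} {y} xy≡z = trans (comm y x) xy≡z

  triple-rotate : ∀ {x y z} → x · y ≡ z → y · z ≡ x
  triple-rotate {x} {y} refl = trans (cong (y ·_) (comm x y)) (cancel y x)

module _ (M N : SteinerQuasigroup) where
  private
    module M = SteinerQuasigroup M
    module N = SteinerQuasigroup N

  Homomorphic : (Carrier M → Carrier N) → Set
  Homomorphic h = ∀ x y → h (x M.· y) ≡ h x N.· h y

  homomorphic-eval : ∀ {h} → Homomorphic h → ∀ (ρ : X → Carrier M) t →
                     h (eval M ρ t) ≡ eval N (h ∘ ρ) t
  homomorphic-eval hom ρ (var x) = refl
  homomorphic-eval hom ρ (s ⊙ t) =
    trans (hom _ _) (cong₂ N._·_ (homomorphic-eval hom ρ s) (homomorphic-eval hom ρ t))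

∘-homomorphic : ∀ L M N {g f} → Homomorphic M N g → Homomorphic L M f → Homomorphic L N (g ∘ f)
∘-homomorphic _ _ _ {g} g-hom f-hom x y = trans (cong g (f-hom x y)) (g-hom _ _)

Z₃ : Set
Z₃ = Fin 3

-- k − s − t in ℤ/3ℤ; twist 0F is the Steiner quasigroup of a single line.
twist : Z₃ → Z₃ → Z₃ → Z₃
twist k s t = (toℕ k + 2 * (toℕ s + toℕ t)) mod 3

twist-comm : ∀ k s t → twist k s t ≡ twist k t s
twist-comm = from-yes (all? λ k → all? λ s → all? λ t → twist k s t Fin.≟ twist k t s)

twist-idem : ∀ s → twist 0F s s ≡ s
twist-idem = from-yes (all? λ s → twist 0F s s Fin.≟ s)

twist-cancel : ∀ k s t → twist k s (twist k s t) ≡ t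
twist-cancel = from-yes (all? λ k → all? λ s → all? λ t → twist k s (twist k s t) Fin.≟ t)

Z₃-steiner : SteinerQuasigroup
Z₃-steiner = record
  { Carrier = Z₃
  ; _·_     = twist 0F
  ; comm    = twist-comm 0F
  ; idem    = twist-idem
  ; cancel  = twist-cancel 0F
  }

indicator : {P : Set} → Dec P → Z₃
indicator (yes _) = 1F
indicator (no _)  = 0F

module _ {P : Set} where
  indicator-yes : (p? : Dec P) → P → indicator p? ≡ 1F
  indicator-yes (yes _) _ = refl
  indicator-yes (no ¬p) p = ⊥-elim (¬p p)

  indicator-no : (p? : Dec P) → ¬ P → indicator p? ≡ 0F
  indicator-no (yes p) ¬p = ⊥-elim (¬p p)
  indicator-no (no _)  _  = refl

  indicator-cong : {Q : Set} → (P → Q) → (Q → P) → (p? : Dec P) (q? : Dec Q) →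
                   indicator p? ≡ indicator q?
  indicator-cong P→Q Q→P p? (yes q) = indicator-yes p? (Q→P q)
  indicator-cong P→Q Q→P p? (no ¬q) = indicator-no p? (¬q ∘ P→Q)

∉-vars⇒indicator-zero : ∀ {b} (_≟_ : DecidableEquality X) (t : Term X) → b ∉ vars t →
                        eval Z₃-steiner (λ x → indicator (x ≟ b)) t ≡ 0F
∉-vars⇒indicator-zero _≟_ (var x) b∉ = indicator-no (x ≟ _) (λ x≡b → b∉ (here (sym x≡b)))
∉-vars⇒indicator-zero _≟_ (s ⊙ t) b∉ = cong₂ (twist 0F)
  (∉-vars⇒indicator-zero _≟_ s (b∉ ∘ ∈-++⁺ˡ))
  (∉-vars⇒indicator-zero _≟_ t (b∉ ∘ ∈-++⁺ʳ (vars s)))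

record FiniteSteinerQuasigroup : Set₁ where
  field
    squag      : SteinerQuasigroup
    enumerable : Enumerable (Carrier squag)

Z₃-finite : FiniteSteinerQuasigroup
Z₃-finite = record { squag = Z₃-steiner ; enumerable = 3 , ↔-refl }

module _ (N : SteinerQuasigroup) where
  open SteinerQuasigroup N hiding (Carrier)

  record Cocycle : Set where
    field
      c        : Carrier N → Carrier N → Z₃
      c-comm   : ∀ x y → c x y ≡ c y x
      c-idem   : ∀ x → c x x ≡ 0F
      c-cancel : ∀ x y → c x (x · y) ≡ c x y

  extension : Cocycle → SteinerQuasigroup
  extension κ = record
    { Carrier = Carrier N × Z₃
    ; _·_     = λ (x , s) (y , t) → x · y , twist (c x y) s t
    ; comm    = λ (x , s) (y , t) → cong₂ _,_ (comm x y)
                  (trans (cong (λ k → twist k s t) (c-comm x y)) (twist-comm (c y x) s t))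
    ; idem    = λ (x , s) → cong₂ _,_ (idem x)
                  (trans (cong (λ k → twist k s s) (c-idem x)) (twist-idem s))
    ; cancel  = λ (x , s) (y , t) → cong₂ _,_ (cancel x y)
                  (trans (cong (λ k → twist k s (twist (c x y) s t)) (c-cancel x y))
                         (twist-cancel (c x y) s t))
    }
    where open Cocycle κ

  zero-cocycle : Cocycle
  zero-cocycle = record
    { c = λ _ _ → 0F ; c-comm = λ _ _ → refl ; c-idem = λ _ → refl ; c-cancel = λ _ _ → refl }

finite-extension : (N : FiniteSteinerQuasigroup) → Cocycle (FiniteSteinerQuasigroup.squag N) →
                   FiniteSteinerQuasigroup
finite-extension N κ = record
  { squag      = extension squag κ
  ; enumerable = ×-enumerable enumerable (3 , ↔-refl)
  }
  where open FiniteSteinerQuasigroup N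

module Block (N : SteinerQuasigroup) (_≟_ : DecidableEquality (Carrier N)) (p q : Carrier N) where
  open SteinerQuasigroup N hiding (Carrier)

  InBlock : Carrier N → Set
  InBlock x = x ≡ p ⊎ x ≡ q ⊎ x ≡ p · q

  Edge : Carrier N → Carrier N → Set
  Edge x y = x ≢ y × InBlock x × InBlock y

  edge? : ∀ x y → Dec (Edge x y)
  edge? x y = ¬? (x ≟ y) ×-dec (inBlock? x ×-dec inBlock? y)
    where
    inBlock? : ∀ x → Dec (InBlock x)
    inBlock? x = (x ≟ p) ⊎-dec ((x ≟ q) ⊎-dec (x ≟ (p · q)))

  block-closed : ∀ {x y} → x ≢ y → InBlock x → InBlock y → InBlock (x · y)
  block-closed x≢y (inj₁ refl)        (inj₁ refl)        = ⊥-elim (x≢y refl)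
  block-closed x≢y (inj₁ refl)        (inj₂ (inj₁ refl)) = inj₂ (inj₂ refl)
  block-closed x≢y (inj₁ refl)        (inj₂ (inj₂ refl)) = inj₂ (inj₁ (cancel p q))
  block-closed x≢y (inj₂ (inj₁ refl)) (inj₁ refl)        = inj₂ (inj₂ (comm q p))
  block-closed x≢y (inj₂ (inj₁ refl)) (inj₂ (inj₁ refl)) = ⊥-elim (x≢y refl)
  block-closed x≢y (inj₂ (inj₁ refl)) (inj₂ (inj₂ refl)) = inj₁ (triple-rotate N refl)
  block-closed x≢y (inj₂ (inj₂ refl)) (inj₁ refl)        = inj₂ (inj₁ (triple-rotate N
                                                                          (triple-rotate N refl)))
  block-closed x≢y (inj₂ (inj₂ refl)) (inj₂ (inj₁ refl)) = inj₁ (triple-swap N (triple-rotate N refl))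
  block-closed x≢y (inj₂ (inj₂ refl)) (inj₂ (inj₂ refl)) = ⊥-elim (x≢y refl)

  edge-sym : ∀ {x y} → Edge x y → Edge y x
  edge-sym (x≢y , x∈ , y∈) = x≢y ∘ sym , y∈ , x∈

  edge-cancel : ∀ {x y} → Edge x (x · y) → Edge x y
  edge-cancel {x} {y} (x≢xy , x∈ , xy∈) =
    (λ x≡y → x≢xy (trans (sym (idem x)) (cong (x ·_) x≡y))) ,
    x∈ ,
    subst InBlock (cancel x y) (block-closed x≢xy x∈ xy∈)

  edge-cancel⁻ : ∀ {x y} → Edge x y → Edge x (x · y)
  edge-cancel⁻ {x} {y} (x≢y , x∈ , y∈) =
    (λ x≡xy → x≢y (trans (sym (idem x)) (trans (cong (x ·_) x≡xy) (cancel x y)))) ,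
    x∈ ,
    block-closed x≢y x∈ y∈

  block-cocycle : Cocycle N
  block-cocycle = record
    { c        = λ x y → indicator (edge? x y)
    ; c-comm   = λ x y → indicator-cong edge-sym edge-sym (edge? x y) (edge? y x)
    ; c-idem   = λ x → indicator-no (edge? x x) (λ (x≢x , _) → x≢x refl)
    ; c-cancel = λ x y → indicator-cong edge-cancel edge-cancel⁻ (edge? x (x · y)) (edge? x y)
    }

-- Residual finiteness: terms are added one at a time to a subterm-closed list Q, keeping a finite
-- model in which equal values on Q force equal values in M.
module Separation (M : SteinerQuasigroup) {X : Set} (_≟X_ : DecidableEquality X) (ρ : X → Carrier M)
  where
  open SteinerQuasigroup M hiding (Carrier)
  open FiniteSteinerQuasigroup
  open DecMembership (Term-≟ _≟X_) using (_∈?_)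

  ⟦_⟧ : Term X → Carrier M
  ⟦_⟧ = eval M ρ

  Reflects : (N : SteinerQuasigroup) → (X → Carrier N) → List (Term X) → Set
  Reflects N α Q = ∀ {z z′} → z ∈ Q → z′ ∈ Q → eval N α z ≡ eval N α z′ → ⟦ z ⟧ ≡ ⟦ z′ ⟧

  SubtermClosed : List (Term X) → Set
  SubtermClosed Q = ∀ {s t} → s ⊙ t ∈ Q → s ∈ Q × t ∈ Q

  record Model (Q : List (Term X)) : Set₁ where
    field
      N        : FiniteSteinerQuasigroup
      α        : X → Carrier (squag N)
      reflects : Reflects (squag N) α Q

  reflects-redundant : ∀ {N α Q w q} → Reflects N α Q → q ∈ Q →
                       ⟦ q ⟧ ≡ ⟦ w ⟧ → eval N α q ≡ eval N α w → Reflects N α (w ∷ Q)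
  reflects-redundant r q∈Q ⟦q⟧≡⟦w⟧ q≈w (here refl) (here refl) _  = refl
  reflects-redundant r q∈Q ⟦q⟧≡⟦w⟧ q≈w (here refl) (there z′∈Q) eq =
    trans (sym ⟦q⟧≡⟦w⟧) (r q∈Q z′∈Q (trans q≈w eq))
  reflects-redundant r q∈Q ⟦q⟧≡⟦w⟧ q≈w (there z∈Q) (here refl) eq =
    trans (r z∈Q q∈Q (trans eq (sym q≈w))) ⟦q⟧≡⟦w⟧
  reflects-redundant r q∈Q ⟦q⟧≡⟦w⟧ q≈w (there z∈Q) (there z′∈Q) eq = r z∈Q z′∈Q eq

  module Extension (N : SteinerQuasigroup) (κ : Cocycle N) (α : X → Carrier N) (s : X → Z₃)
    where
    open Cocycle κ
    open SteinerQuasigroup N using () renaming (_·_ to _∙_)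

    N′ : SteinerQuasigroup
    N′ = extension N κ

    α′ : X → Carrier N′
    α′ = < α , s >

    level : Term X → Z₃
    level t = proj₂ (eval N′ α′ t)

    eval-proj₁ : ∀ t → proj₁ (eval N′ α′ t) ≡ eval N α t
    eval-proj₁ (var x) = refl
    eval-proj₁ (t ⊙ u) = cong₂ _∙_ (eval-proj₁ t) (eval-proj₁ u)

    level-⊙ : ∀ t u → level (t ⊙ u) ≡ twist (c (eval N α t) (eval N α u)) (level t) (level u)
    level-⊙ t u = cong (λ k → twist k (level t) (level u)) (cong₂ c (eval-proj₁ t) (eval-proj₁ u))

    level-zero : ∀ {Q} → SubtermClosed Q → (∀ {x} → var x ∈ Q → s x ≡ 0F) →
                 (∀ {t u} → t ⊙ u ∈ Q → c (eval N α t) (eval N α u) ≡ 0F) →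
                 ∀ {z} → z ∈ Q → level z ≡ 0F
    level-zero closed vars-zero c-zero {var x} z∈Q = vars-zero z∈Q
    level-zero closed vars-zero c-zero {t ⊙ u} z∈Q
      rewrite level-⊙ t u | c-zero z∈Q
            | level-zero closed vars-zero c-zero (proj₁ (closed z∈Q))
            | level-zero closed vars-zero c-zero (proj₂ (closed z∈Q)) = refl

    reflects-separated : ∀ {Q w} → Reflects N α Q → (∀ {z} → z ∈ Q → level z ≡ 0F) →
                         level w ≡ 1F → Reflects N′ α′ (w ∷ Q)
    reflects-separated r Q-zero w-one (here refl) (here refl) _ = refl
    reflects-separated r Q-zero w-one (here refl) (there z′∈Q) eq
      with () ← trans (sym w-one) (trans (cong proj₂ eq) (Q-zero z′∈Q))
    reflects-separated r Q-zero w-one (there z∈Q) (here refl) eq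
      with () ← trans (sym w-one) (trans (cong proj₂ (sym eq)) (Q-zero z∈Q))
    reflects-separated r Q-zero w-one {z = z} {z′} (there z∈Q) (there z′∈Q) eq =
      r z∈Q z′∈Q (trans (sym (eval-proj₁ z)) (trans (cong proj₁ eq) (eval-proj₁ z′)))

  model-∷-var : ∀ {Q x} → SubtermClosed Q → var x ∉ Q → Model Q → Model (var x ∷ Q)
  model-∷-var {Q} {x} closed x∉Q 𝓜 = record
    { N        = finite-extension N (zero-cocycle (squag N))
    ; α        = α′
    ; reflects = reflects-separated reflects (level-zero closed vars-zero (λ _ → refl))
                   (indicator-yes (x ≟X x) refl)
    }
    where
    open Model 𝓜
    s : X → Z₃
    s y = indicator (y ≟X x)
    open Extension (squag N) (zero-cocycle (squag N)) α s
    vars-zero : ∀ {y} → var y ∈ Q → s y ≡ 0F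
    vars-zero y∈Q = indicator-no (_ ≟X x) (λ { refl → x∉Q y∈Q })

  module NodeStep {Q u v} (closed : SubtermClosed Q) (u∈Q : u ∈ Q) (v∈Q : v ∈ Q) (𝓜 : Model Q)
    where
    open Model 𝓜

    N₀ : SteinerQuasigroup
    N₀ = squag N

    open SteinerQuasigroup N₀ using () renaming (_·_ to _∙_; idem to ∙-idem; cancel to ∙-cancel)

    ⟪_⟫ : Term X → Carrier N₀
    ⟪_⟫ = eval N₀ α

    p q : Carrier N₀
    p = ⟪ u ⟫
    q = ⟪ v ⟫

    open Block N₀ (enumerable⇒≟ (enumerable N)) p q

    w : Term X
    w = u ⊙ v

    via-triple : ∀ {y₁ y₂ y₃} → y₁ ∈ Q → y₂ ∈ Q → y₃ ∈ Q → ⟦ y₁ ⟧ · ⟦ y₂ ⟧ ≡ ⟦ y₃ ⟧ →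
                 ⟪ y₁ ⟫ ∙ ⟪ y₂ ⟫ ≡ ⟪ y₃ ⟫ → ⟪ y₁ ⟫ ≡ p → ⟪ y₂ ⟫ ≡ q → Model (w ∷ Q)
    via-triple y₁∈Q y₂∈Q y₃∈Q M-triple N-triple y₁≈u y₂≈v = record
      { N        = N
      ; α        = α
      ; reflects = reflects-redundant reflects y₃∈Q
          (trans (sym M-triple) (cong₂ _·_ (reflects y₁∈Q u∈Q y₁≈u) (reflects y₂∈Q v∈Q y₂≈v)))
          (trans (sym N-triple) (cong₂ _∙_ y₁≈u y₂≈v))
      }

    coincident : p ≡ q → Model (w ∷ Q)
    coincident p≡q = record
      { N        = N
      ; α        = α
      ; reflects = reflects-redundant reflects u∈Q
          (trans (sym (idem ⟦ u ⟧)) (cong (⟦ u ⟧ ·_) (reflects u∈Q v∈Q p≡q)))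
          (trans (sym (∙-idem p)) (cong (p ∙_) p≡q))
      }

    EdgeBelow : Term X → Set
    EdgeBelow (var _) = ⊥
    EdgeBelow (t ⊙ t′) = Edge ⟪ t ⟫ ⟪ t′ ⟫

    edgeBelow? : ∀ z → Dec (EdgeBelow z)
    edgeBelow? (var _) = no λ ()
    edgeBelow? (t ⊙ t′) = edge? ⟪ t ⟫ ⟪ t′ ⟫

    -- z₁, z₂ and z₁ ⊙ z₂ land on the three vertices of the triangle {p, q, p · q}; the one landing
    -- on p · q is the product of the other two, hence a copy of w already in Q.
    on-edge : ∀ z → z ∈ Q → EdgeBelow z → Model (w ∷ Q)
    on-edge (z₁ ⊙ z₂) z∈Q (a≢b , a∈ , b∈) = triangle a∈ b∈
      where
      z₁∈Q = proj₁ (closed z∈Q)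
      z₂∈Q = proj₂ (closed z∈Q)
      triangle : InBlock ⟪ z₁ ⟫ → InBlock ⟪ z₂ ⟫ → Model (w ∷ Q)
      triangle (inj₁ a≡p) (inj₁ b≡p) = ⊥-elim (a≢b (trans a≡p (sym b≡p)))
      triangle (inj₂ (inj₁ a≡q)) (inj₂ (inj₁ b≡q)) = ⊥-elim (a≢b (trans a≡q (sym b≡q)))
      triangle (inj₂ (inj₂ a≡r)) (inj₂ (inj₂ b≡r)) = ⊥-elim (a≢b (trans a≡r (sym b≡r)))
      triangle (inj₁ a≡p) (inj₂ (inj₁ b≡q)) = via-triple z₁∈Q z₂∈Q z∈Q refl refl a≡p b≡q
      triangle (inj₂ (inj₁ a≡q)) (inj₁ b≡p) =
        via-triple z₂∈Q z₁∈Q z∈Q (triple-swap M refl) (triple-swap N₀ refl) b≡p a≡q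
      triangle (inj₁ a≡p) (inj₂ (inj₂ b≡r)) =
        via-triple z₁∈Q z∈Q z₂∈Q (cancel _ _) (∙-cancel _ _) a≡p
          (trans (cong₂ _∙_ a≡p b≡r) (∙-cancel p q))
      triangle (inj₂ (inj₂ a≡r)) (inj₁ b≡p) =
        via-triple z₂∈Q z∈Q z₁∈Q (triple-rotate M refl) (triple-rotate N₀ refl) b≡p
          (trans (cong₂ _∙_ a≡r b≡p) (triple-rotate N₀ (triple-rotate N₀ refl)))
      triangle (inj₂ (inj₁ a≡q)) (inj₂ (inj₂ b≡r)) =
        via-triple z∈Q z₁∈Q z₂∈Q (triple-rotate M (triple-rotate M refl))
          (triple-rotate N₀ (triple-rotate N₀ refl))
          (trans (cong₂ _∙_ a≡q b≡r) (triple-rotate N₀ refl)) a≡q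
      triangle (inj₂ (inj₂ a≡r)) (inj₂ (inj₁ b≡q)) =
        via-triple z∈Q z₂∈Q z₁∈Q (triple-swap M (triple-rotate M refl))
          (triple-swap N₀ (triple-rotate N₀ refl))
          (trans (cong₂ _∙_ a≡r b≡q) (triple-swap N₀ (triple-rotate N₀ refl))) b≡q

    -- No edge of the triangle occurs below Q, so the block cocycle vanishes on Q but not on w.
    off-edges : p ≢ q → ¬ Any.Any EdgeBelow Q → Model (w ∷ Q)
    off-edges p≢q no-edge = record
      { N        = finite-extension N block-cocycle
      ; α        = α′
      ; reflects = reflects-separated reflects Q-zero w-one
      }
      where
      open Extension N₀ block-cocycle α (λ _ → 0F)
      Q-zero : ∀ {z} → z ∈ Q → level z ≡ 0F
      Q-zero = level-zero closed (λ _ → refl)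
                 (λ t⊙u∈Q → indicator-no (edge? _ _) (no-edge ∘ lose t⊙u∈Q))
      w-one : level w ≡ 1F
      w-one rewrite level-⊙ u v | Q-zero u∈Q | Q-zero v∈Q
        | indicator-yes (edge? p q) (p≢q , inj₁ refl , inj₂ (inj₁ refl)) = refl

    model : Model (w ∷ Q)
    model with enumerable⇒≟ (enumerable N) p q
    ... | yes p≡q = coincident p≡q
    ... | no p≢q with Any.any? edgeBelow? Q
    ...   | yes edge-below = let z , z∈Q , edge = find edge-below in on-edge z z∈Q edge
    ...   | no no-edge = off-edges p≢q no-edge

  record Stage : Set₁ where
    field
      terms  : List (Term X)
      closed : SubtermClosed terms
      model  : Model terms
  open Stage

  ChildrenIn : List (Term X) → Term X → Set
  ChildrenIn Q (var _) = ⊤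
  ChildrenIn Q (s ⊙ t) = s ∈ Q × t ∈ Q

  Grows : Stage → Term X → Set₁
  Grows S t = Σ Stage λ S′ → terms S ⊆ terms S′ × t ∈ terms S′

  push : (S : Stage) (w : Term X) → ChildrenIn (terms S) w → Grows S w
  push S w children with w ∈? terms S
  ... | yes w∈S = S , (λ z∈S → z∈S) , w∈S
  ... | no w∉S = S′ , there , here refl
    where
    closed-∷ : ∀ w → ChildrenIn (terms S) w → SubtermClosed (w ∷ terms S)
    closed-∷ (s ⊙ t) (s∈S , t∈S) (here refl) = there s∈S , there t∈S
    closed-∷ w _ (there st∈S) = there (proj₁ (closed S st∈S)) , there (proj₂ (closed S st∈S))
    model-∷ : ∀ w → ChildrenIn (terms S) w → w ∉ terms S → Model (w ∷ terms S)
    model-∷ (var x) _ x∉S = model-∷-var (closed S) x∉S (model S)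
    model-∷ (s ⊙ t) (s∈S , t∈S) _ = NodeStep.model (closed S) s∈S t∈S (model S)
    S′ : Stage
    S′ = record { terms = w ∷ terms S ; closed = closed-∷ w children ; model = model-∷ w children w∉S }

  grow : (S : Stage) (t : Term X) → Grows S t
  grow S (var x) = push S (var x) tt
  grow S (t ⊙ u) with grow S t
  ... | S₁ , S⊆S₁ , t∈S₁ with grow S₁ u
  ... | S₂ , S₁⊆S₂ , u∈S₂ with push S₂ (t ⊙ u) (S₁⊆S₂ t∈S₁ , u∈S₂)
  ... | S₃ , S₂⊆S₃ , w∈S₃ = S₃ , ⊆-trans (⊆-trans S⊆S₁ S₁⊆S₂) S₂⊆S₃ , w∈S₃

  initial : Stage
  initial = record
    { terms  = []
    ; closed = λ ()
    ; model  = record { N = Z₃-finite ; α = λ _ → 0F ; reflects = λ () }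
    }

  separate : ∀ t t′ → Σ FiniteSteinerQuasigroup λ N → Σ (X → Carrier (squag N)) λ α →
             (eval (squag N) α t ≡ eval (squag N) α t′ → ⟦ t ⟧ ≡ ⟦ t′ ⟧)
  separate t t′ with grow initial t
  ... | S₁ , _ , t∈S₁ with grow S₁ t′
  ... | S₂ , S₁⊆S₂ , t′∈S₂ = N , α , reflects (S₁⊆S₂ t∈S₁) t′∈S₂
    where open Model (model S₂)

El-≟ : {A : Subset X} → DecidableEquality X → IsProp A → DecidableEquality (El A)
El-≟ _≟_ A-prop (x , a) (y , b) with x ≟ y
... | yes refl = yes (cong (x ,_) (A-prop x a b))
... | no x≢y = no (x≢y ∘ cong proj₁)

module _ (M : SteinerQuasigroup) where
  open SteinerQuasigroup M hiding (Carrier)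
  open FiniteSteinerQuasigroup

  term : ∀ {S x} → ⟨_⟩ M S x → Term (El S)
  term (base {x} s) = var (x , s)
  term (op d d′) = term d ⊙ term d′

  eval-term : ∀ {S x} (d : ⟨_⟩ M S x) → eval M proj₁ (term d) ≡ x
  eval-term (base _) = refl
  eval-term (op d d′) = cong₂ _·_ (eval-term d) (eval-term d′)

  derivation : ∀ {S} (t : Term (El S)) → ⟨_⟩ M S (eval M proj₁ t)
  derivation (var (_ , s)) = base s
  derivation (t ⊙ t′) = op (derivation t) (derivation t′)

  -- Generation is witnessed by a choice of terms, which reduces equality in M to equality of terms.
  generated-≟ : ∀ {S} → Generates M S → DecidableEquality (El S) → DecidableEquality (Carrier M)
  generated-≟ gen _≟S_ x y = map′
    (λ tx≡ty → trans (sym (eval-term (gen x)))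
                     (trans (cong (eval M proj₁) tx≡ty) (eval-term (gen y))))
    (cong (λ z → term (gen z)))
    (Term-≟ _≟S_ (term (gen x)) (term (gen y)))

  homomorphisms-agree : ∀ N {R h h′} → Generates M R → Homomorphic M N h → Homomorphic M N h′ →
                        (∀ {r} → R r → h r ≡ h′ r) → ∀ x → h x ≡ h′ x
  homomorphisms-agree N {R} {h} {h′} gen hom hom′ agree x = on-derivation (gen x)
    where
    on-derivation : ∀ {x} → ⟨_⟩ M R x → h x ≡ h′ x
    on-derivation (base r) = agree r
    on-derivation (op d d′) = trans (hom _ _)
      (trans (cong₂ (SteinerQuasigroup._·_ N) (on-derivation d) (on-derivation d′)) (sym (hom′ _ _)))

  PreservesRelations : Subset (Carrier M) → Set₁
  PreservesRelations S = ∀ N (g : El S → Carrier N) t t′ →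
                         eval M proj₁ t ≡ eval M proj₁ t′ → eval N g t ≡ eval N g t′

  independent⇒preservesRelations : ∀ {S} → Independent M S → PreservesRelations S
  independent⇒preservesRelations {S} ind N g t t′ eq = begin
    eval N g t                ≡⟨ extension-eval t ⟨
    fun (_ , derivation t)    ≡⟨ fun-irrelevant eq (derivation t) (derivation t′) ⟩
    fun (_ , derivation t′)   ≡⟨ extension-eval t′ ⟩
    eval N g t′               ∎
    where
    open ≡-Reasoning
    open SubHom (proj₁ (ind N g)) using (fun; wd; hom)
    extension-eval : ∀ t → fun (eval M proj₁ t , derivation t) ≡ eval N g t
    extension-eval (var (x , s)) = proj₂ (ind N g) x s
    extension-eval (t ⊙ t′) = trans (hom _ _ (derivation t) (derivation t′))
      (cong₂ (SteinerQuasigroup._·_ N) (extension-eval t) (extension-eval t′))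
    fun-irrelevant : ∀ {x y} → x ≡ y → (d : ⟨_⟩ M S x) (d′ : ⟨_⟩ M S y) →
                     fun (x , d) ≡ fun (y , d′)
    fun-irrelevant refl = wd _

  preservesRelations⇒independent : ∀ {S} → PreservesRelations S → Independent M S
  preservesRelations⇒independent pres N g = evaluation , λ _ _ → refl
    where
    evaluation : SubHom M _ N
    evaluation = record
      { fun = λ (_ , d) → eval N g (term d)
      ; wd  = λ _ d d′ → pres N g (term d) (term d′) (trans (eval-term d) (sym (eval-term d′)))
      ; hom = λ _ _ _ _ → refl
      }

  -- If b ∉ vars t, the valuation sending b to 1 and everything else to 0 gives t the value 0.
  evaluates-to-generator⇒∈-vars : ∀ {S} → PreservesRelations S → DecidableEquality (El S) →
                                   ∀ t b → eval M proj₁ t ≡ proj₁ b → b ∈ vars t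
  evaluates-to-generator⇒∈-vars pres _≟_ t b t≡b with DecMembership._∈?_ _≟_ b (vars t)
  ... | yes b∈t = b∈t
  ... | no b∉t with () ← trans (sym (∉-vars⇒indicator-zero _≟_ t b∉t))
                          (trans (pres Z₃-steiner (λ x → indicator (x ≟ b)) t (var b) t≡b)
                                 (indicator-yes (b ≟ b) refl))

  -- Every element of a free base R occurs in the R-terms expressing the finitely many elements of S.
  free-base-enumerable : ∀ {n S R} → Fin n ↔ El S → Generates M S → PreservesRelations R →
                         Generates M R → DecidableEquality (El R) → Enumerable (El R)
  free-base-enumerable {n} {S} {R} eS genS presR genR _≟_ = listed⇒enumerable _≟_ listing complete
    where
    open Inverse eS
    σ : El S → Term (El R)
    σ a = term (genR (proj₁ a))
    listed-by : Fin n → List (El R)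
    listed-by i = vars (σ (to i))
    listing : List (El R)
    listing = concatMap listed-by (allFin n)
    complete : ∀ b → b ∈ listing
    complete b
      with ∈-vars-bind τ σ (evaluates-to-generator⇒∈-vars presR _≟_ (bind τ σ) b evaluates-to-b)
      where
      τ = term (genS (proj₁ b))
      evaluates-to-b : eval M proj₁ (bind τ σ) ≡ proj₁ b
      evaluates-to-b = begin
        eval M proj₁ (bind τ σ)      ≡⟨ eval-bind M proj₁ σ τ ⟩
        eval M (eval M proj₁ ∘ σ) τ  ≡⟨ eval-cong M (λ a → eval-term (genR (proj₁ a))) τ ⟩
        eval M proj₁ τ               ≡⟨ eval-term (genS (proj₁ b)) ⟩
        proj₁ b                      ∎
        where open ≡-Reasoning
    ... | a , b∈σa = ∈-concatMap⁺ listed-by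
      (lose (∈-allFin (from a)) (subst (λ a′ → b ∈ vars (σ a′)) (sym (strictlyInverseˡ a)) b∈σa))

  module FreeExtension {S : Subset (Carrier M)} (pres : PreservesRelations S) (gen : Generates M S)
    where

    lift : (N : SteinerQuasigroup) → (El S → Carrier N) → Carrier M → Carrier N
    lift N g x = eval N g (term (gen x))

    lift-eval : ∀ N g t → lift N g (eval M proj₁ t) ≡ eval N g t
    lift-eval N g t = pres N g (term (gen _)) t (eval-term (gen _))

    lift-var : ∀ N g (a : El S) → lift N g (proj₁ a) ≡ g a
    lift-var N g a = lift-eval N g (var a)

    lift-homomorphic : ∀ N g → Homomorphic M N (lift N g)
    lift-homomorphic N g x y = begin
      lift N g (x · y)                             ≡⟨ cong (lift N g) terms-eval ⟨
      lift N g (eval M proj₁ (term dx ⊙ term dy))  ≡⟨ lift-eval N g (term dx ⊙ term dy) ⟩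
      SteinerQuasigroup._·_ N (lift N g x) (lift N g y)  ∎
      where
      open ≡-Reasoning
      dx = gen x
      dy = gen y
      terms-eval : eval M proj₁ (term dx ⊙ term dy) ≡ x · y
      terms-eval = cong₂ _·_ (eval-term dx) (eval-term dy)

    restriction-injective : ∀ N {R} → Generates M R →
      PointwiseInjective (λ (g : El S → Carrier N) (r : El R) → lift N g (proj₁ r))
    restriction-injective N genR g g′ agree a = begin
      g a                  ≡⟨ lift-var N g a ⟨
      lift N g (proj₁ a)   ≡⟨ homomorphisms-agree N genR (lift-homomorphic N g) (lift-homomorphic N g′)
                                (λ r → agree (_ , r)) (proj₁ a) ⟩
      lift N g′ (proj₁ a)  ≡⟨ lift-var N g′ a ⟩
      g′ a                 ∎
      where open ≡-Reasoning

    free-≤-generating : ∀ {k r R} → Fin k ↔ El S → Generates M R → Fin r ↔ El R → k ≤ r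
    free-≤-generating eS genR eR =
      pointwiseInjective⇒≤ eS eR ↔-refl (s≤s (s≤s z≤n)) (restriction-injective Z₃-steiner genR)

    separating-valuation : DecidableEquality (El S) → ∀ x y →
      Σ FiniteSteinerQuasigroup λ N → Σ (El S → Carrier (squag N)) λ α →
      (lift (squag N) α x ≡ lift (squag N) α y → x ≡ y)
    separating-valuation _≟_ x y with Separation.separate M _≟_ proj₁ (term (gen x)) (term (gen y))
    ... | N , α , separates =
      N , α , λ eq → trans (sym (eval-term (gen x))) (trans (separates eq) (eval-term (gen y)))

    module Equinumerous {n R} (eS : Fin n ↔ El S) (genR : Generates M R) (e : El S ↔ El R) where
      open Inverse e

      φ : Carrier M → Carrier M
      φ = lift M (proj₁ ∘ to)

      pullback : ∀ N → (El S → Carrier N) → (El S → Carrier N)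
      pullback N β a = lift N β (proj₁ (to a))

      pullback-injective : ∀ N → PointwiseInjective (pullback N)
      pullback-injective N β β′ agree = restriction-injective N genR β β′ λ b →
        subst (λ b′ → lift N β (proj₁ b′) ≡ lift N β′ (proj₁ b′)) (strictlyInverseˡ b)
              (agree (from b))

      lift-factors : ∀ N α β → (∀ a → pullback N β a ≡ α a) → ∀ x → lift N α x ≡ lift N β (φ x)
      lift-factors N α β β≈α = homomorphisms-agree N gen (lift-homomorphic N α)
        (∘-homomorphic M M N (lift-homomorphic N β) (lift-homomorphic M (proj₁ ∘ to)))
        λ {a} s → begin
          lift N α a                     ≡⟨ lift-var N α (a , s) ⟩
          α (a , s)                      ≡⟨ β≈α (a , s) ⟨
          lift N β (proj₁ (to (a , s)))  ≡⟨ cong (lift N β) (lift-var M (proj₁ ∘ to) (a , s)) ⟨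
          lift N β (φ a)                 ∎
        where open ≡-Reasoning

      -- Over a finite N the injective pullback is onto, so a valuation separating x from y
      -- factors through φ.
      φ-injective : ∀ x y → φ x ≡ φ y → x ≡ y
      φ-injective x y φx≡φy with separating-valuation (enumerable⇒≟ (n , eS)) x y
      ... | 𝓝 , α , separates
          with pointwiseInjective⇒surjective eS (enumerable 𝓝) (pullback-injective (squag 𝓝)) α
      ...   | β , β≈α = separates (begin
        lift N α x      ≡⟨ lift-factors N α β β≈α x ⟩
        lift N β (φ x)  ≡⟨ cong (lift N β) φx≡φy ⟩
        lift N β (φ y)  ≡⟨ lift-factors N α β β≈α y ⟨
        lift N α y      ∎)
        where
        open ≡-Reasoning
        N = squag 𝓝

      φ-eval : ∀ t → φ (eval M proj₁ (bind t (var ∘ from))) ≡ eval M proj₁ t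
      φ-eval t = begin
        φ (eval M proj₁ (bind t (var ∘ from)))  ≡⟨ cong φ (eval-bind M proj₁ (var ∘ from) t) ⟩
        φ (eval M (proj₁ ∘ from) t)             ≡⟨ homomorphic-eval M M φ-homomorphic (proj₁ ∘ from) t ⟩
        eval M (φ ∘ proj₁ ∘ from) t             ≡⟨ eval-cong M φ-from t ⟩
        eval M proj₁ t                          ∎
        where
        open ≡-Reasoning
        φ-homomorphic = lift-homomorphic M (proj₁ ∘ to)
        φ-from : ∀ b → φ (proj₁ (from b)) ≡ proj₁ b
        φ-from b = trans (lift-var M (proj₁ ∘ to) (from b)) (cong proj₁ (strictlyInverseˡ b))

      preservesRelations : PreservesRelations R
      preservesRelations N g t t′ t≈t′ = begin
        eval N g t                 ≡⟨ eval-cong N (cong g ∘ strictlyInverseˡ) t ⟨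
        eval N (g ∘ to ∘ from) t   ≡⟨ eval-bind N (g ∘ to) (var ∘ from) t ⟨
        eval N (g ∘ to) (pull t)   ≡⟨ pres N (g ∘ to) (pull t) (pull t′) pulled-relation ⟩
        eval N (g ∘ to) (pull t′)  ≡⟨ eval-bind N (g ∘ to) (var ∘ from) t′ ⟩
        eval N (g ∘ to ∘ from) t′  ≡⟨ eval-cong N (cong g ∘ strictlyInverseˡ) t′ ⟩
        eval N g t′                ∎
        where
        open ≡-Reasoning
        pull : Term (El R) → Term (El S)
        pull t = bind t (var ∘ from)
        pulled-relation : eval M proj₁ (pull t) ≡ eval M proj₁ (pull t′)
        pulled-relation = φ-injective _ _ (trans (φ-eval t) (trans t≈t′ (sym (φ-eval t′))))

  free-bases-equinumerous : ∀ {n S R} → Fin n ↔ El S → PreservesRelations S → Generates M S →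
                            IsProp R → PreservesRelations R → Generates M R → El S ↔ El R
  free-bases-equinumerous {n} eS presS genS R-prop presR genR
    with free-base-enumerable eS genS presR genR (El-≟ (generated-≟ genS (enumerable⇒≟ (n , eS))) R-prop)
  ... | m , eR with ≤-antisym (FreeExtension.free-≤-generating presS genS eS genR eR)
                              (FreeExtension.free-≤-generating presR genR eR genS eS)
  ... | refl = ↔-trans (↔-sym eS) eR

corollary2p8 : (M : SteinerQuasigroup) (A B : Subset (SteinerQuasigroup.Carrier M)) →
    IsProp A → IsProp B → Finite A → FreeBase M A → Generates M B →
    SameCard A B ⇔ FreeBase M B
corollary2p8 M A B _ B-prop (n , eA) A-free genB = mk⇔ equinumerous⇒free free⇒equinumerous
  where
  open FreeBase A-free renaming (independent to indA; generating to genA)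
  presA : PreservesRelations M A
  presA = independent⇒preservesRelations M indA

  equinumerous⇒free : SameCard A B → FreeBase M B
  equinumerous⇒free e = record
    { independent = preservesRelations⇒independent M
        (FreeExtension.Equinumerous.preservesRelations M presA genA eA genB e)
    ; generating  = genB
    }

  free⇒equinumerous : FreeBase M B → SameCard A B
  free⇒equinumerous B-free = free-bases-equinumerous M eA presA genA B-prop
    (independent⇒preservesRelations M (FreeBase.independent B-free)) genB
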